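{- Fix an integer $k\ge 1$. For $n\ge 1$ let $a_{n,k}$ be the number of binary trees of size $n$ having exactly $k$ segments on the right branch, and let $c_n=\frac{1}{n+1}\binom{2n}{n}$ be the total number of binary trees of size $n$. Then \[\lim_{n\to\infty}\frac{a_{n,k}}{c_n}=\frac{k}{2^{k+1}}.\]
   Context: A binary tree is defined recursively to be either a single external node, or an internal node connected to two binary trees, its left subtree and its right subtree. The size of a binary tree is its number of internal nodes (a tree of size $n$ has $n+1$ external nodes and $2n+1$ nodes in total). The right branch of a binary tree is the path that starts at the root and repeatedly passes to the right subtree until an external node is reached; the number of segments on the right branch is the number of edges on this path. -}

module Defs where

open import Data.Nat using (ℕ; zero; suc; _+_; _*_; _^_)
open import Data.Nat.Combinatorics using (_C_)
open import Data.Integer using (+_)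
open import Data.Rational using (ℚ; _/_; 0ℚ)
import Data.Nat.DivMod as ND

data Tree : Set where
  leaf : Tree
  node : Tree → Tree → Tree

size : Tree → ℕ
size leaf       = 0
size (node l r) = suc (size l + size r)

-- number of edges on the right branch
rightSegments : Tree → ℕ
rightSegments leaf       = 0
rightSegments (node l r) = suc (rightSegments r)

catalan : ℕ → ℕ
catalan n = ND._/_ ((n + n) C n) (suc n)

-- the rational p/q (q is always positive where used; 0 for q = 0)
frac : ℕ → ℕ → ℚ
frac p zero    = 0ℚ
frac p (suc q) = (+ p) / suc q

-- Write n = m + k. Deleting the root of a tree whose left subtree is a leaf, and otherwise
-- rotating node (node a b) c ↦ node a (node b c), which lengthens the right branch by one,
-- yields the ballot recurrence, whence a_{n,k} = k (2m+k-1)! / (m! (m+k)!) and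
--   a_{n,k} / c_n = k (m+1)(m+2)⋯(m+k+1) / ((2m+k)(2m+k+1)⋯(2m+2k)).
-- Both products have k+1 factors, lying in [m, m+k+1] and [2m, 2(m+k+1)] respectively, so
-- 2^(k+1) a_{n,k} / (k c_n) lies between (m/(m+k+1))^(k+1) and its inverse. A Bernoulli-type
-- inequality turns this into |2^(k+1) a_{n,k} - k c_n| (m - (k+1)²) ≤ k c_n (k+1)², and the
-- distance to k/2^(k+1) drops below any rational ε once m is large.

module Submission where

open import Defs
open import Data.Empty using (⊥-elim)
open import Data.Fin using (Fin; zero)
open import Data.Fin.Permutation using (↔⇒≡)
open import Data.Fin.Properties using (+↔⊎)
open import Data.List using (_∷_; [])
open import Data.Nat as ℕ using (ℕ; zero; suc; _+_; _*_; _∸_; _/_; _^_; _!; _≤_; z≤n; s≤s; z<s; NonZero; >-nonZero)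
open import Data.Nat.Combinatorics using (_C_; k![n∸k]!∣n!)
open import Data.Nat.Combinatorics.Specification using (nCk≡n!/k![n-k]!)
open import Data.Nat.DivMod using (m/n*n≡m; m*n/n≡m)
open import Data.Nat.Properties
open import Data.Nat.Tactic.RingSolver using (solve; solve-∀)
import Data.Integer as ℤ
open import Data.Integer using (+_; -[1+_]; _⊖_; +<+)
import Data.Integer.Properties as ℤ
open import Data.Product using (Σ; _×_; _,_; proj₁; ∃-syntax)
open import Data.Rational using (ℚ; mkℚ; 0ℚ; _<_; _-_; -_; ∣_∣; ↧ₙ_; toℚᵘ; *<*)
open import Data.Rational.Properties using (toℚᵘ-cancel-<; toℚᵘ-homo-∣-∣; toℚᵘ-homo-+; toℚᵘ-homo‿-; toℚᵘ-fromℚᵘ)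
import Data.Rational.Unnormalised as ℚᵘ
import Data.Rational.Unnormalised.Properties as ℚᵘ
open import Data.Sum using (_⊎_; inj₁; inj₂)
open import Data.Sum.Function.Propositional using (_⊎-↔_)
open import Function.Bundles using (_↔_; mk↔ₛ′)
open import Function.Properties.Inverse using (↔-refl; ↔-sym; ↔-trans)
open import Relation.Binary.PropositionalEquality
open import Relation.Nullary using (contradiction)
open import Algebra.Properties.CommutativeSemigroup *-commutativeSemigroup
  using (x∙yz≈y∙xz; x∙yz≈y∙zx; xy∙z≈y∙xz; xy∙z≈xz∙y; interchange)

Trees : ℕ → ℕ → Set
Trees n k = Σ Tree λ t → size t ≡ n × rightSegments t ≡ k

Trees-≡ : ∀ {n k} {x y : Trees n k} → proj₁ x ≡ proj₁ y → x ≡ y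
Trees-≡ {x = t , p , q} {y = .t , p′ , q′} refl =
  cong₂ (λ p q → t , p , q) (≡-irrelevant p p′) (≡-irrelevant q q′)

Trees-cast : ∀ {n n′ k} → n ≡ n′ → Trees n k ↔ Trees n′ k
Trees-cast refl = ↔-refl

rightSegments≤size : ∀ t → rightSegments t ≤ size t
rightSegments≤size leaf       = z≤n
rightSegments≤size (node l r) = s≤s (≤-trans (rightSegments≤size r) (m≤n+m (size r) (size l)))

comb : ℕ → Tree
comb zero    = leaf
comb (suc j) = node leaf (comb j)

size-comb : ∀ j → size (comb j) ≡ j
size-comb zero    = refl
size-comb (suc j) = cong suc (size-comb j)

rightSegments-comb : ∀ j → rightSegments (comb j) ≡ j
rightSegments-comb zero    = refl
rightSegments-comb (suc j) = cong suc (rightSegments-comb j)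

size≡rightSegments⇒comb : ∀ t → size t ≡ rightSegments t → t ≡ comb (rightSegments t)
size≡rightSegments⇒comb leaf                _  = refl
size≡rightSegments⇒comb (node leaf r)       eq = cong (node leaf) (size≡rightSegments⇒comb r (suc-injective eq))
size≡rightSegments⇒comb (node (node a b) r) eq = ⊥-elim (n≮n (size r) (begin-strict
  size r                          <⟨ m<n+m (size r) z<s ⟩
  suc (size a + size b) + size r  ≡⟨ suc-injective eq ⟩
  rightSegments r                 ≤⟨ rightSegments≤size r ⟩
  size r                          ∎))
  where open ≤-Reasoning

Trees-diagonal : ∀ j → Trees j j ↔ Fin 1
Trees-diagonal j = mk↔ₛ′ (λ _ → zero) (λ _ → comb-tree) (λ { zero → refl }) comb-unique
  where
  comb-tree : Trees j j
  comb-tree = comb j , size-comb j , rightSegments-comb j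
  comb-unique : ∀ x → comb-tree ≡ x
  comb-unique (t , p , q) = Trees-≡ (sym (trans (size≡rightSegments⇒comb t (trans p (sym q))) (cong comb q)))

Trees-suc-zero : ∀ n → Trees (suc n) 0 ↔ Fin 0
Trees-suc-zero n = mk↔ₛ′ absurd (λ ()) (λ ()) (λ x → absurd x)
  where
  absurd : ∀ {A : Set} → Trees (suc n) 0 → A
  absurd (leaf , () , _)
  absurd (node _ _ , _ , ())

size-rotate : ∀ a b c → size (node (node a b) c) ≡ size (node a (node b c))
size-rotate a b c = cong suc (trans (cong suc (+-assoc (size a) (size b) (size c))) (sym (+-suc (size a) (size b + size c))))

Trees-split : ∀ n j → Trees (suc n) (suc j) ↔ (Trees n j ⊎ Trees (suc n) (suc (suc j)))
Trees-split n j = mk↔ₛ′ to from to∘from from∘to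
  where
  to : Trees (suc n) (suc j) → Trees n j ⊎ Trees (suc n) (suc (suc j))
  to (node leaf r , p , q)         = inj₁ (r , suc-injective p , suc-injective q)
  to (node (node a b) r , p , q)   = inj₂ (node a (node b r) , trans (sym (size-rotate a b r)) p , cong suc q)

  from : Trees n j ⊎ Trees (suc n) (suc (suc j)) → Trees (suc n) (suc j)
  from (inj₁ (r , p , q))                  = node leaf r , cong suc p , cong suc q
  from (inj₂ (node a (node b r) , p , q))  = node (node a b) r , trans (size-rotate a b r) p , suc-injective q
  from (inj₂ (leaf , _ , ()))
  from (inj₂ (node _ leaf , _ , ()))

  to∘from : ∀ y → to (from y) ≡ y
  to∘from (inj₁ _)                          = cong inj₁ (Trees-≡ refl)
  to∘from (inj₂ (node a (node b r) , _ , _)) = cong inj₂ (Trees-≡ refl)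
  to∘from (inj₂ (leaf , _ , ()))
  to∘from (inj₂ (node _ leaf , _ , ()))

  from∘to : ∀ x → from (to x) ≡ x
  from∘to (node leaf _ , _ , _)       = Trees-≡ refl
  from∘to (node (node _ _) _ , _ , _) = Trees-≡ refl

-- Indexed by m = size − j, so that the recurrence of Trees-split is structural.
ballot : ℕ → ℕ → ℕ
ballot zero    j       = 1
ballot (suc m) zero    = 0
ballot (suc m) (suc j) = ballot (suc m) j + ballot m (suc (suc j))

Trees↔ballot : ∀ m j → Trees (m + j) j ↔ Fin (ballot m j)
Trees↔ballot zero    j       = Trees-diagonal j
Trees↔ballot (suc m) zero    = Trees-suc-zero (m + 0)
Trees↔ballot (suc m) (suc j) =
  ↔-trans (Trees-split (m + suc j) j)
  (↔-trans (Trees-cast (+-suc m j) ⊎-↔ Trees-cast (sym (+-suc m (suc j))))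
  (↔-trans (Trees↔ballot (suc m) j ⊎-↔ Trees↔ballot m (suc (suc j)))
           (↔-sym +↔⊎)))

card-Trees : ∀ m j {a} → Fin a ↔ Trees (m + j) j → a ≡ ballot m j
card-Trees m j e = ↔⇒≡ (↔-trans e (Trees↔ballot m j))

!-+-suc : ∀ a b → (a + suc b) ! ≡ (a + suc b) * (a + b) !
!-+-suc a b rewrite +-suc a b = refl

-- f, g and x stand for m !, (m + j + 2) ! and (2m + j + 2) !.
ballot-step-algebra : ∀ m j b₁ b₂ f g x →
  b₁ * (suc m * f * g) ≡ suc j * x →
  b₂ * (f * ((suc m + suc (suc j)) * g)) ≡ suc (suc (suc j)) * x →
  (b₁ + b₂) * (suc m * f * ((suc m + suc (suc j)) * g)) ≡ suc (suc j) * ((suc m + suc m + suc j) * x)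
ballot-step-algebra m j b₁ b₂ f g x h₁ h₂ = begin
  (b₁ + b₂) * (suc m * f * ((suc m + suc (suc j)) * g))
    ≡⟨ solve (m ∷ j ∷ b₁ ∷ b₂ ∷ f ∷ g ∷ []) ⟩
  (suc m + suc (suc j)) * (b₁ * (suc m * f * g)) + suc m * (b₂ * (f * ((suc m + suc (suc j)) * g)))
    ≡⟨ cong₂ (λ u v → (suc m + suc (suc j)) * u + suc m * v) h₁ h₂ ⟩
  (suc m + suc (suc j)) * (suc j * x) + suc m * (suc (suc (suc j)) * x)
    ≡⟨ solve (m ∷ j ∷ x ∷ []) ⟩
  suc (suc j) * ((suc m + suc m + suc j) * x) ∎
  where open ≡-Reasoning

ballot-base-algebra : ∀ m b f g x → b * (f * g) ≡ 2 * x → b * (suc m * f * g) ≡ 1 * (suc (m + suc m + 0) * x)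
ballot-base-algebra m b f g x h = begin
  b * (suc m * f * g)                ≡⟨ solve (m ∷ b ∷ f ∷ g ∷ []) ⟩
  suc m * (b * (f * g))              ≡⟨ cong (suc m *_) h ⟩
  suc m * (2 * x)                    ≡⟨ solve (m ∷ x ∷ []) ⟩
  1 * (suc (m + suc m + 0) * x)      ∎
  where open ≡-Reasoning

ballot-closed : ∀ m j → ballot m (suc j) * (m ! * (m + suc j) !) ≡ suc j * (m + m + j) !
ballot-closed zero j = trans (*-identityˡ _) (*-identityˡ _)
ballot-closed (suc m) zero = begin
  ballot m 2 * (suc m ! * (suc m + 1) !)
    ≡⟨ cong (λ n → ballot m 2 * (suc m ! * n !)) (sym (+-suc m 1)) ⟩
  ballot m 2 * (suc m ! * (m + 2) !)
    ≡⟨ ballot-base-algebra m (ballot m 2) (m !) ((m + 2) !) ((m + suc m + 0) !) ih ⟩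
  1 * (suc m + suc m + 0) ! ∎
  where
  open ≡-Reasoning
  ih : ballot m 2 * (m ! * (m + 2) !) ≡ 2 * (m + suc m + 0) !
  ih = trans (ballot-closed m 1) (cong (λ n → 2 * n !) {m + m + 1} {m + suc m + 0} (solve (m ∷ [])))
ballot-closed (suc m) (suc j) = begin
  (b₁ + b₂) * (suc m ! * (suc m + suc (suc j)) !)
    ≡⟨ cong (λ n → (b₁ + b₂) * (suc m ! * n)) (!-+-suc (suc m) (suc j)) ⟩
  (b₁ + b₂) * (suc m ! * ((suc m + suc (suc j)) * (suc m + suc j) !))
    ≡⟨ ballot-step-algebra m j b₁ b₂ (m !) ((suc m + suc j) !) ((suc m + suc m + j) !) (ballot-closed (suc m) j) ih₂ ⟩
  suc (suc j) * ((suc m + suc m + suc j) * (suc m + suc m + j) !)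
    ≡⟨ cong (suc (suc j) *_) (sym (!-+-suc (suc m + suc m) j)) ⟩
  suc (suc j) * (suc m + suc m + suc j) ! ∎
  where
  open ≡-Reasoning
  b₁ b₂ : ℕ
  b₁ = ballot (suc m) (suc j)
  b₂ = ballot m (suc (suc (suc j)))
  ih₂ : b₂ * (m ! * ((suc m + suc (suc j)) * (suc m + suc j) !)) ≡ suc (suc (suc j)) * (suc m + suc m + j) !
  ih₂ = begin
    b₂ * (m ! * ((suc m + suc (suc j)) * (suc m + suc j) !))
      ≡⟨ cong (λ n → b₂ * (m ! * n)) (sym (!-+-suc (suc m) (suc j))) ⟩
    b₂ * (m ! * (suc m + suc (suc j)) !)
      ≡⟨ cong (λ n → b₂ * (m ! * n !)) (sym (+-suc m (suc (suc j)))) ⟩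
    b₂ * (m ! * (m + suc (suc (suc j))) !)
      ≡⟨ ballot-closed m (suc (suc j)) ⟩
    suc (suc (suc j)) * (m + m + suc (suc j)) !
      ≡⟨ cong (λ n → suc (suc (suc j)) * n !) {m + m + suc (suc j)} {suc m + suc m + j} (solve (m ∷ j ∷ [])) ⟩
    suc (suc (suc j)) * (suc m + suc m + j) ! ∎

central-binomial : ∀ n → ((n + n) C n) * (n ! * n !) ≡ (n + n) !
central-binomial n = begin
  ((n + n) C n) * (n ! * n !)
    ≡⟨ cong (λ x → ((n + n) C n) * (n ! * x !)) (sym (m+n∸n≡m n n)) ⟩
  ((n + n) C n) * (n ! * (n + n ∸ n) !)
    ≡⟨ cong (_* (n ! * (n + n ∸ n) !)) (nCk≡n!/k![n-k]! (m≤n+m n n)) ⟩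
  ((n + n) ! / (n ! * (n + n ∸ n) !)) * (n ! * (n + n ∸ n) !)
    ≡⟨ m/n*n≡m (k![n∸k]!∣n! (m≤n+m n n)) ⟩
  (n + n) ! ∎
  where
  open ≡-Reasoning
  instance
    n!*[n+n∸n]!≢0 : NonZero (n ! * (n + n ∸ n) !)
    n!*[n+n∸n]!≢0 = n !* (n + n ∸ n) !≢0

ballot₁-closed : ∀ n → ballot n 1 * (n ! * suc n !) ≡ (n + n) !
ballot₁-closed n = begin
  ballot n 1 * (n ! * suc n !)    ≡⟨ cong (λ x → ballot n 1 * (n ! * x !)) (+-comm 1 n) ⟩
  ballot n 1 * (n ! * (n + 1) !)  ≡⟨ ballot-closed n 0 ⟩
  1 * (n + n + 0) !               ≡⟨ *-identityˡ _ ⟩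
  (n + n + 0) !                   ≡⟨ cong _! (+-identityʳ (n + n)) ⟩
  (n + n) !                       ∎
  where open ≡-Reasoning

catalan≡ballot : ∀ n → catalan n ≡ ballot n 1
catalan≡ballot n = begin
  ((n + n) C n) / suc n       ≡⟨ cong (_/ suc n) central≡ballot*suc ⟩
  ballot n 1 * suc n / suc n  ≡⟨ m*n/n≡m (ballot n 1) (suc n) ⟩
  ballot n 1                  ∎
  where
  open ≡-Reasoning
  rearrange : ∀ b n f → b * (f * (suc n * f)) ≡ b * suc n * (f * f)
  rearrange = solve-∀
  central≡ballot*suc : ((n + n) C n) ≡ ballot n 1 * suc n
  central≡ballot*suc = *-cancelʳ-≡ _ _ (n ! * n !) {{n !* n !≢0}} (begin
    ((n + n) C n) * (n ! * n !)      ≡⟨ central-binomial n ⟩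
    (n + n) !                        ≡⟨ sym (ballot₁-closed n) ⟩
    ballot n 1 * (n ! * suc n !)     ≡⟨ rearrange (ballot n 1) n (n !) ⟩
    ballot n 1 * suc n * (n ! * n !) ∎)

catalan-closed : ∀ n → catalan n * (n ! * suc n !) ≡ (n + n) !
catalan-closed n = trans (cong (_* (n ! * suc n !)) (catalan≡ballot n)) (ballot₁-closed n)

catalan-nonZero : ∀ n → NonZero (catalan n)
catalan-nonZero n = m*n≢0⇒m≢0 (catalan n) {{subst NonZero (sym (catalan-closed n)) ((n + n) !≢0)}}

rising : ℕ → ℕ → ℕ
rising x zero    = 1
rising x (suc p) = suc (x + p) * rising x p

!-+ : ∀ x p → (x + p) ! ≡ x ! * rising x p
!-+ x zero    = trans (cong _! (+-identityʳ x)) (sym (*-identityʳ (x !)))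
!-+ x (suc p) = begin
  (x + suc p) !                        ≡⟨ cong _! (+-suc x p) ⟩
  suc (x + p) * (x + p) !              ≡⟨ cong (suc (x + p) *_) (!-+ x p) ⟩
  suc (x + p) * (x ! * rising x p)     ≡⟨ x∙yz≈y∙xz (suc (x + p)) (x !) (rising x p) ⟩
  x ! * rising x (suc p)               ∎
  where open ≡-Reasoning

^≤rising : ∀ x p → x ^ p ≤ rising x p
^≤rising x zero    = ≤-refl
^≤rising x (suc p) = *-mono-≤ (≤-trans (m≤m+n x p) (n≤1+n _)) (^≤rising x p)

rising≤^ : ∀ x p → rising x p ≤ (x + p) ^ p
rising≤^ x zero    = ≤-refl
rising≤^ x (suc p) = *-mono-≤ (≤-reflexive (sym (+-suc x p)))
  (≤-trans (rising≤^ x p) (^-monoˡ-≤ p (+-monoʳ-≤ x (n≤1+n p))))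

ballot-ratio : ∀ m j → ballot m (suc j) * rising (m + m + j) (suc (suc j))
                       ≡ suc j * catalan (m + suc j) * rising m (suc (suc j))
ballot-ratio m j = *-cancelʳ-≡ _ _ (m ! * n !) {{m !* n !≢0}} (begin
  a * R₁ * (m ! * n !)               ≡⟨ xy∙z≈y∙xz a R₁ (m ! * n !) ⟩
  R₁ * (a * (m ! * n !))             ≡⟨ cong (R₁ *_) (ballot-closed m j) ⟩
  R₁ * (k * (m + m + j) !)           ≡⟨ x∙yz≈y∙zx R₁ k ((m + m + j) !) ⟩
  k * ((m + m + j) ! * R₁)           ≡⟨ cong (k *_) (sym (!-+ (m + m + j) (suc k))) ⟩
  k * (m + m + j + suc k) !          ≡⟨ cong (λ x → k * x !) {m + m + j + suc (suc j)} {m + suc j + (m + suc j)} (solve (m ∷ j ∷ [])) ⟩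
  k * (n + n) !                      ≡⟨ cong (k *_) (sym (catalan-closed n)) ⟩
  k * (c * (n ! * suc n !))          ≡⟨ cong (λ x → k * (c * (n ! * x !))) (sym (+-suc m k)) ⟩
  k * (c * (n ! * (m + suc k) !))    ≡⟨ cong (λ x → k * (c * (n ! * x))) (!-+ m (suc k)) ⟩
  k * (c * (n ! * (m ! * R₂)))       ≡⟨ rearrange k c (n !) (m !) R₂ ⟩
  k * c * R₂ * (m ! * n !)           ∎)
  where
  open ≡-Reasoning
  k n a c R₁ R₂ : ℕ
  k = suc j
  n = m + k
  a = ballot m k
  c = catalan n
  R₁ = rising (m + m + j) (suc k)
  R₂ = rising m (suc k)
  rearrange : ∀ a b c d e → a * (b * (c * (d * e))) ≡ a * b * e * (d * c)
  rearrange = solve-∀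

^-distribʳ-* : ∀ a b n → (a * b) ^ n ≡ a ^ n * b ^ n
^-distribʳ-* a b zero    = refl
^-distribʳ-* a b (suc n) = begin
  a * b * (a * b) ^ n      ≡⟨ cong (a * b *_) (^-distribʳ-* a b n) ⟩
  a * b * (a ^ n * b ^ n)  ≡⟨ interchange a b (a ^ n) (b ^ n) ⟩
  a * a ^ n * (b * b ^ n)  ∎
  where open ≡-Reasoning

n<2^n : ∀ n → n ℕ.< 2 ^ n
n<2^n zero    = z<s
n<2^n (suc n) = begin-strict
  suc n          ≡⟨ +-comm 1 n ⟩
  n + 1          <⟨ +-mono-<-≤ (n<2^n n) (m^n>0 2 n) ⟩
  2 ^ n + 2 ^ n  ≡⟨ cong (_+_ (2 ^ n)) (sym (+-identityʳ (2 ^ n))) ⟩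
  2 ^ suc n      ∎
  where open ≤-Reasoning

+-*-exchange : ∀ {y M} d → y ≤ M → (M + d) * y ≤ M * (y + d)
+-*-exchange {y} {M} d y≤M = begin
  (M + d) * y    ≡⟨ *-distribʳ-+ y M d ⟩
  M * y + d * y  ≤⟨ +-monoʳ-≤ (M * y) (≤-trans (*-monoʳ-≤ d y≤M) (≤-reflexive (*-comm d M))) ⟩
  M * y + M * d  ≡⟨ sym (*-distribˡ-+ M y d) ⟩
  M * (y + d)    ∎
  where open ≤-Reasoning

-- (1 + d/M)^p (1 − p d/M) ≤ 1 for M = y + p d, with denominators cleared.
^-shift-bound : ∀ p d y → (y + p * d + d) ^ p * y ≤ (y + p * d) ^ suc p
^-shift-bound zero    d y = ≤-reflexive (trans (*-identityˡ y) (sym (trans (*-identityʳ (y + 0)) (+-identityʳ y))))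
^-shift-bound (suc p) d y = begin
  (M + d) ^ suc p * y            ≡⟨ xy∙z≈y∙xz (M + d) ((M + d) ^ p) y ⟩
  (M + d) ^ p * ((M + d) * y)    ≤⟨ *-monoʳ-≤ ((M + d) ^ p) (+-*-exchange d (m≤m+n y (suc p * d))) ⟩
  (M + d) ^ p * (M * (y + d))    ≡⟨ x∙yz≈y∙xz ((M + d) ^ p) M (y + d) ⟩
  M * ((M + d) ^ p * (y + d))    ≤⟨ *-monoʳ-≤ M shifted ⟩
  M ^ suc (suc p)                ∎
  where
  open ≤-Reasoning
  M : ℕ
  M = y + suc p * d
  shifted : (M + d) ^ p * (y + d) ≤ M ^ suc p
  shifted = subst (λ u → (u + d) ^ p * (y + d) ≤ u ^ suc p) (+-assoc y d (p * d)) (^-shift-bound p d (y + d))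

^-shift-cancel : ∀ p a b y → a * (y + p * p) ^ p ≤ b * (y + p * p + p) ^ p → a * y ≤ b * (y + p * p)
^-shift-cancel p a b zero    _ = ≤-trans (≤-reflexive (*-zeroʳ a)) z≤n
^-shift-cancel p a b y@(suc _) h = *-cancelʳ-≤ (a * y) (b * m) (m ^ p) {{m^n≢0 m p}} (begin
  a * y * m ^ p         ≡⟨ xy∙z≈xz∙y a y (m ^ p) ⟩
  a * m ^ p * y         ≤⟨ *-monoˡ-≤ y h ⟩
  b * (m + p) ^ p * y   ≡⟨ *-assoc b _ y ⟩
  b * ((m + p) ^ p * y) ≤⟨ *-monoʳ-≤ b (^-shift-bound p p y) ⟩
  b * (m * m ^ p)       ≡⟨ sym (*-assoc b m (m ^ p)) ⟩
  b * m * m ^ p         ∎)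
  where
  open ≤-Reasoning
  m : ℕ
  m = y + p * p

∸-*-bound : ∀ a b {y w} → a * y ≤ b * (y + w) → (a ∸ b) * y ≤ b * w
∸-*-bound a b {y} {w} h = begin
  (a ∸ b) * y            ≡⟨ *-distribʳ-∸ y a b ⟩
  a * y ∸ b * y          ≤⟨ ∸-monoˡ-≤ (b * y) h ⟩
  b * (y + w) ∸ b * y    ≡⟨ cong (_∸ b * y) (*-distribˡ-+ b y w) ⟩
  b * y + b * w ∸ b * y  ≡⟨ m+n∸m≡n (b * y) (b * w) ⟩
  b * w                  ∎
  where open ≤-Reasoning

∣⊖∣*y≤*w : ∀ a b {y w} → a * y ≤ b * (y + w) → b * y ≤ a * (y + w) → ℤ.∣ a ⊖ b ∣ * y ≤ b * w
∣⊖∣*y≤*w a b {y} {w} ay≤ by≤ with ≤-total a b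
... | inj₁ a≤b = begin
  ℤ.∣ a ⊖ b ∣ * y  ≡⟨ cong (_* y) (ℤ.∣⊖∣-≤ a≤b) ⟩
  (b ∸ a) * y      ≤⟨ ∸-*-bound b a by≤ ⟩
  a * w            ≤⟨ *-monoˡ-≤ w a≤b ⟩
  b * w            ∎
  where open ≤-Reasoning
... | inj₂ b≤a = begin
  ℤ.∣ a ⊖ b ∣ * y  ≡⟨ cong (_* y) (trans (ℤ.∣m⊖n∣≡∣n⊖m∣ a b) (ℤ.∣⊖∣-≤ b≤a)) ⟩
  (a ∸ b) * y      ≤⟨ ∸-*-bound a b ay≤ ⟩
  b * w            ∎
  where open ≤-Reasoning

∣⊖∣*q≤ : ∀ a b {y w} q → a * y ≤ b * (y + w) → b * y ≤ a * (y + w) → w * q ℕ.< y → ℤ.∣ a ⊖ b ∣ * q ≤ b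
∣⊖∣*q≤ a b {y} {w} q ay≤ by≤ wq<y = *-cancelʳ-≤ _ b y {{>-nonZero (≤-<-trans z≤n wq<y)}} (begin
  ℤ.∣ a ⊖ b ∣ * q * y    ≡⟨ xy∙z≈xz∙y ℤ.∣ a ⊖ b ∣ q y ⟩
  ℤ.∣ a ⊖ b ∣ * y * q    ≤⟨ *-monoˡ-≤ q (∣⊖∣*y≤*w a b ay≤ by≤) ⟩
  b * w * q              ≡⟨ *-assoc b w q ⟩
  b * (w * q)            ≤⟨ *-monoʳ-≤ b (<⇒≤ wq<y) ⟩
  b * y                  ∎)
  where open ≤-Reasoning

-- ε ≥ 1 / ↧ₙ ε, so it suffices to beat the denominator of ε.
frac-dist< : ∀ a c b d (ε : ℚ) → 0ℚ < ε →
             ℤ.∣ a * d ⊖ b * c ∣ * ↧ₙ ε ℕ.< c * d → ∣ frac a c - frac b d ∣ < ε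
frac-dist< a zero    b d       ε _ ()
frac-dist< a (suc c) b zero    ε _ h = contradiction (<-≤-trans h (≤-reflexive (*-zeroʳ (suc c)))) n≮0
frac-dist< a (suc c) b (suc d) (mkℚ (+ zero) _ _)   (*<* (+<+ ()))
frac-dist< a (suc c) b (suc d) (mkℚ -[1+ _ ] _ _)   (*<* ())
frac-dist< a (suc c) b (suc d) ε@(mkℚ (+ suc p) e _) _ h =
  toℚᵘ-cancel-< (ℚᵘ.<-respˡ-≃ (ℚᵘ.≃-sym toℚᵘ-dist) dist<ε)
  where
  X Y : ℚᵘ.ℚᵘ
  X = ℚᵘ.mkℚᵘ (+ a) c
  Y = ℚᵘ.mkℚᵘ (+ b) d
  δ : ℕ
  δ = ℤ.∣ a * suc d ⊖ b * suc c ∣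
  toℚᵘ-dist : toℚᵘ ∣ frac a (suc c) - frac b (suc d) ∣ ℚᵘ.≃ ℚᵘ.∣ X ℚᵘ.- Y ∣
  toℚᵘ-dist = ℚᵘ.≃-trans (toℚᵘ-homo-∣-∣ (frac a (suc c) - frac b (suc d))) (ℚᵘ.∣-∣-cong
    (ℚᵘ.≃-trans (toℚᵘ-homo-+ (frac a (suc c)) (- frac b (suc d)))
      (ℚᵘ.+-cong (toℚᵘ-fromℚᵘ X) (ℚᵘ.≃-trans (toℚᵘ-homo‿- (frac b (suc d))) (ℚᵘ.-‿cong (toℚᵘ-fromℚᵘ Y))))))
  numerator : + a ℤ.* + suc d ℤ.+ ℤ.- (+ b) ℤ.* + suc c ≡ a * suc d ⊖ b * suc c
  numerator = trans
    (cong₂ ℤ._+_ (sym (ℤ.pos-* a (suc d))) (trans (sym (ℤ.neg-distribˡ-* (+ b) (+ suc c))) (cong ℤ.-_ (sym (ℤ.pos-* b (suc c))))))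
    (ℤ.m-n≡m⊖n (a * suc d) (b * suc c))
  dist<ε : ℚᵘ.∣ X ℚᵘ.- Y ∣ ℚᵘ.< toℚᵘ ε
  dist<ε = ℚᵘ.*<* (subst₂ ℤ._<_
    (trans (ℤ.pos-* δ (suc e)) (cong (λ n → + ℤ.∣ n ∣ ℤ.* + suc e) (sym numerator)))
    (ℤ.pos-* (suc p) (suc c * suc d))
    (+<+ (<-≤-trans h (m≤n*m _ (suc p)))))

module RatioBounds (j : ℕ) where

  k P w : ℕ
  k = suc j
  P = suc k
  w = P * P

  ballot-lower : ∀ m → ballot m k * 2 ^ P * m ^ P ≤ k * catalan (m + k) * (m + P) ^ P
  ballot-lower m = begin
    a * 2 ^ P * m ^ P             ≡⟨ *-assoc a _ _ ⟩
    a * (2 ^ P * m ^ P)           ≡⟨ cong (a *_) (sym (^-distribʳ-* 2 m P)) ⟩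
    a * (2 * m) ^ P               ≤⟨ *-monoʳ-≤ a (^-monoˡ-≤ P 2m≤m+m+j) ⟩
    a * (m + m + j) ^ P           ≤⟨ *-monoʳ-≤ a (^≤rising (m + m + j) P) ⟩
    a * rising (m + m + j) P      ≡⟨ ballot-ratio m j ⟩
    k * c * rising m P            ≤⟨ *-monoʳ-≤ (k * c) (rising≤^ m P) ⟩
    k * c * (m + P) ^ P           ∎
    where
    open ≤-Reasoning
    a c : ℕ
    a = ballot m k
    c = catalan (m + k)
    2m≤m+m+j : 2 * m ≤ m + m + j
    2m≤m+m+j = ≤-trans (≤-reflexive (cong (_+_ m) (+-identityʳ m))) (m≤m+n (m + m) j)

  ballot-upper : ∀ m → k * catalan (m + k) * m ^ P ≤ ballot m k * 2 ^ P * (m + P) ^ P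
  ballot-upper m = begin
    k * c * m ^ P                 ≤⟨ *-monoʳ-≤ (k * c) (^≤rising m P) ⟩
    k * c * rising m P            ≡⟨ sym (ballot-ratio m j) ⟩
    a * rising (m + m + j) P      ≤⟨ *-monoʳ-≤ a (rising≤^ (m + m + j) P) ⟩
    a * (m + m + j + P) ^ P       ≤⟨ *-monoʳ-≤ a (^-monoˡ-≤ P m+m+j+P≤2[m+P]) ⟩
    a * (2 * (m + P)) ^ P         ≡⟨ cong (a *_) (^-distribʳ-* 2 (m + P) P) ⟩
    a * (2 ^ P * (m + P) ^ P)     ≡⟨ sym (*-assoc a _ _) ⟩
    a * 2 ^ P * (m + P) ^ P       ∎
    where
    open ≤-Reasoning
    a c : ℕ
    a = ballot m k
    c = catalan (m + k)
    index : ∀ m j → m + m + j + suc (suc j) + 2 ≡ 2 * (m + suc (suc j))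
    index = solve-∀
    m+m+j+P≤2[m+P] : m + m + j + P ≤ 2 * (m + P)
    m+m+j+P≤2[m+P] = ≤-trans (m≤m+n _ 2) (≤-reflexive (index m j))

  ballot-close : ∀ y q → w * q ℕ.< y →
    ℤ.∣ ballot (y + w) k * 2 ^ P ⊖ k * catalan (y + w + k) ∣ * q ℕ.< catalan (y + w + k) * 2 ^ P
  ballot-close y q wq<y = begin-strict
    ℤ.∣ a * 2 ^ P ⊖ k * c ∣ * q  ≤⟨ ∣⊖∣*q≤ (a * 2 ^ P) (k * c) q lower upper wq<y ⟩
    k * c                        <⟨ *-monoˡ-< c {{catalan-nonZero (y + w + k)}} (<-trans (n<1+n k) (n<2^n P)) ⟩
    2 ^ P * c                    ≡⟨ *-comm (2 ^ P) c ⟩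
    c * 2 ^ P                    ∎
    where
    open ≤-Reasoning
    a c : ℕ
    a = ballot (y + w) k
    c = catalan (y + w + k)
    lower : a * 2 ^ P * y ≤ k * c * (y + w)
    lower = ^-shift-cancel P (a * 2 ^ P) (k * c) y (ballot-lower (y + w))
    upper : k * c * y ≤ a * 2 ^ P * (y + w)
    upper = ^-shift-cancel P (k * c) (a * 2 ^ P) y (ballot-upper (y + w))

mainTheorem3 : (k : ℕ) → 1 ≤ k → (a : ℕ → ℕ) →
    ((n : ℕ) → 1 ≤ n → Fin (a n) ↔ Σ Tree (λ t → size t ≡ n × rightSegments t ≡ k)) →
    (ε : ℚ) → 0ℚ < ε → ∃[ N ] ((n : ℕ) → N ≤ n →
    ∣ frac (a n) (catalan n) - frac k (2 ^ suc k) ∣ < ε)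
mainTheorem3 (suc j) _ a trees ε ε>0 = suc (w * q) + w + k , eventually
  where
  open RatioBounds j using (k; P; w; ballot-close)
  q : ℕ
  q = ↧ₙ ε
  Close : ℕ → Set
  Close n = ∣ frac (a n) (catalan n) - frac k (2 ^ P) ∣ < ε
  close : ∀ y → w * q ℕ.< y → Close (y + w + k)
  close y wq<y = subst (λ x → ∣ frac x (catalan n) - frac k (2 ^ P) ∣ < ε)
    (sym (card-Trees (y + w) k (trees n (≤-trans (s≤s z≤n) (m≤n+m k (y + w))))))
    (frac-dist< (ballot (y + w) k) (catalan n) k (2 ^ P) ε ε>0 (ballot-close y q wq<y))
    where
    n : ℕ
    n = y + w + k
  reorder : ∀ a b c d → a + d + b + c ≡ a + b + c + d
  reorder = solve-∀
  eventually : ∀ n → suc (w * q) + w + k ≤ n → Close n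
  eventually n N≤n with m≤n⇒∃[o]m+o≡n N≤n
  ... | o , refl = subst Close (reorder (suc (w * q)) w k o) (close (suc (w * q) + o) (m≤m+n (suc (w * q)) o))
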